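{- Let $d$ be a positive integer and $\preceq$ a relaxed monomial order on $\mathbb{N}^d$ with $\mathbf{e}_1\prec\mathbf{e}_2\prec\cdots\prec\mathbf{e}_d$. Let $S\in\operatorname{R}_\preceq(\mathcal{S}_d)$ and suppose $\operatorname{H}(S)\cap\{\mathbf{e}_1,\ldots,\mathbf{e}_d\}=\{\mathbf{e}_{j_1}\prec\mathbf{e}_{j_2}\}$ for some $\{j_1,j_2\}\subseteq\{1,\ldots,d\}$. Then $\{\mathbf{e}_{j_1},\mathbf{e}_{j_2}\}=\{\mathbf{e}_1,\mathbf{e}_2\}$.
   Context: $\mathbf{e}_1,\ldots,\mathbf{e}_d$ are the standard basis vectors of $\mathbb{R}^d$ (with $\mathbf{e}_1=(0,\ldots,0,1)$, $\ldots$, $\mathbf{e}_d=(1,0,\ldots,0)$). A generalized numerical semigroup (GNS) in $\mathbb{N}^d$ is a submonoid $S$ of $(\mathbb{N}^d,+)$ with $\operatorname{H}(S)=\mathbb{N}^d\setminus S$ finite; $|\operatorname{H}(S)|$ is its genus; $\mathcal{S}_d$ is the set of GNSs in $\mathbb{N}^d$ and $\mathcal{S}_{g,d}$ those of genus $g$. $\operatorname{P}_d$ is the set of permutations of $\{1,\ldots,d\}$, acting by $\sigma(\sum x_i\mathbf{e}_i)=\sum x_i\mathbf{e}_{\sigma(i)}$ and elementwise on sets; $[S]_\simeq=\{\sigma(S)\mid\sigma\in\operatorname{P}_d\}$. A relaxed monomial order is a total order $\preceq$ on $\mathbb{N}^d$ with $\mathbf{0}\preceq\mathbf{v}$ for all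 $\mathbf{v}$ and such that $\mathbf{v}\prec\mathbf{w}$ implies $\mathbf{v}\prec\mathbf{w}+\mathbf{u}$ for all $\mathbf{u}$. For $S,S'\in\mathcal{S}_{g,d}$ with gaps $\mathbf{h}_1\prec\cdots\prec\mathbf{h}_g$ and $\mathbf{h}'_1\prec\cdots\prec\mathbf{h}'_g$, $S\preceq_{\operatorname{R}}S'$ means $S=S'$ or $\mathbf{h}_r\prec\mathbf{h}'_r$ for $r=\min\{i\mid\mathbf{h}_i\neq\mathbf{h}'_i\}$; $\operatorname{R}_\preceq(S)=\min_{\preceq_{\operatorname{R}}}[S]_\simeq$ and $\operatorname{R}_\preceq(\mathcal{S}_d)=\{\operatorname{R}_\preceq(S)\mid S\in\mathcal{S}_d\}$. -}

module Defs where

open import Data.Nat using (ℕ; zero; suc; _+_)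
open import Data.Fin using (Fin; toℕ) renaming (_<_ to _<ᶠ_)
open import Data.Vec using (Vec; replicate; zipWith; tabulate; lookup; _[_]≔_)
open import Data.List using (List; []; _∷_)
open import Data.List.Membership.Propositional using (_∈_)
open import Data.List.Relation.Unary.Linked using (Linked)
open import Data.Product using (Σ; ∃; _×_; _,_)
open import Data.Sum using (_⊎_)
open import Relation.Nullary using (¬_)
open import Level using (0ℓ)
open import Relation.Binary using (Rel; IsTotalOrder)
open import Relation.Binary.PropositionalEquality using (_≡_; _≢_)
open import Data.Fin.Permutation using (Permutation′; _⟨$⟩ˡ_)
open import Function.Bundles using (_⇔_)

-- Points of ℕ^d, written in the basis e_1,…,e_d: the entry at index i : Fin d
-- is the coefficient of e_(i+1).  (The paper's positional convention
-- e_1 = (0,…,0,1) is only a choice of coordinates and is encoded here by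
-- indexing coefficients by the basis vector they multiply.)
Pt : ℕ → Set
Pt d = Vec ℕ d

𝟎 : ∀ {d} → Pt d
𝟎 {d} = replicate d 0

_⊕_ : ∀ {d} → Pt d → Pt d → Pt d
_⊕_ = zipWith _+_

𝐞 : ∀ {d} → Fin d → Pt d
𝐞 i = 𝟎 [ i ]≔ 1

PSet : ℕ → Set₁
PSet d = Pt d → Set

record IsGNS {d : ℕ} (S : PSet d) : Set where
  field
    has-zero  : S 𝟎
    closed    : ∀ x y → S x → S y → S (x ⊕ y)
    finiteGaps : Σ (List (Pt d)) λ L → ∀ x → ¬ S x → x ∈ L

Strict : ∀ {d} → Rel (Pt d) 0ℓ → Rel (Pt d) 0ℓ
Strict _⪯_ v w = v ⪯ w × v ≢ w

record IsRelaxedMonomialOrder {d : ℕ} (_⪯_ : Rel (Pt d) 0ℓ) : Set where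
  field
    isTotalOrder : IsTotalOrder _≡_ _⪯_
    zero-least   : ∀ v → 𝟎 ⪯ v
    compat       : ∀ v w u → Strict _⪯_ v w → Strict _⪯_ v (w ⊕ u)

-- action of a permutation: σ(Σ x_i e_i) = Σ x_i e_σ(i)
act : ∀ {d} → Permutation′ d → Pt d → Pt d
act σ x = tabulate λ j → lookup x (σ ⟨$⟩ˡ j)

actSet : ∀ {d} → Permutation′ d → PSet d → PSet d
actSet σ S y = ∃ λ x → S x × act σ x ≡ y

SortedGaps : ∀ {d} → Rel (Pt d) 0ℓ → PSet d → List (Pt d) → Set
SortedGaps _⪯_ S hs = Linked (Strict _⪯_) hs × (∀ x → (x ∈ hs) ⇔ (¬ S x))

data FirstDiffLess {d} (_⪯_ : Rel (Pt d) 0ℓ) : List (Pt d) → List (Pt d) → Set where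
  here  : ∀ {x y xs ys} → Strict _⪯_ x y → FirstDiffLess _⪯_ (x ∷ xs) (y ∷ ys)
  there : ∀ {x xs ys} → FirstDiffLess _⪯_ xs ys → FirstDiffLess _⪯_ (x ∷ xs) (x ∷ ys)

_≤R[_]_ : ∀ {d} → PSet d → Rel (Pt d) 0ℓ → PSet d → Set
S ≤R[ _⪯_ ] S' =
  (∀ x → S x ⇔ S' x) ⊎
  (∀ hs hs' → SortedGaps _⪯_ S hs → SortedGaps _⪯_ S' hs' → FirstDiffLess _⪯_ hs hs')

IsRepOf : ∀ {d} → Rel (Pt d) 0ℓ → PSet d → PSet d → Set
IsRepOf _⪯_ S S₀ =
  (∃ λ σ → ∀ x → S x ⇔ actSet σ S₀ x) × (∀ σ → S ≤R[ _⪯_ ] actSet σ S₀)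

InR : ∀ {d} → Rel (Pt d) 0ℓ → PSet d → Set₁
InR {d} _⪯_ S = Σ (PSet d) λ S₀ → IsGNS S₀ × IsRepOf _⪯_ S S₀

{-# OPTIONS --safe #-}
module Submission where

-- In a representative S, the basis vectors that are gaps form an initial segment of
-- e_1 ≺ e_2 ≺ ⋯.  Suppose e_t ∈ S but e_j ∉ S with t < j, and let τ swap the
-- coordinates t and j.  A gap x ⪯ e_t of S has x_t = 0 (otherwise e_t ⪯ x, so x = e_t)
-- and x_j = 0 (otherwise e_j ⪯ x ⪯ e_t), so τ fixes it and it is also a gap of τ(S);
-- moreover e_t = τ(e_j) is a gap of τ(S) but not of S.  Hence where the sorted gap lists
-- of S and τ(S) first differ, τ(S) has the smaller gap, contradicting the minimality of S.
-- An initial segment with exactly two elements is {e_1, e_2}.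

open import Defs
open import Data.Nat using (ℕ; zero; suc; _≤_; _+_; _∸_; s≤s; z≤n)
open import Data.Nat.Properties using (m+[n∸m]≡n) renaming (_≟_ to _≟ℕ_)
open import Data.Fin using (Fin; toℕ) renaming (_<_ to _<ᶠ_; zero to 0F; suc to sucF)
open import Data.Fin.Properties using (_≟_; <-cmp; <⇒≢)
import Data.Fin.Permutation.Components as PC
open import Data.Fin.Permutation
  using (Permutation′; _⟨$⟩ˡ_; _⟨$⟩ʳ_; flip; _∘ₚ_; transpose; inverseˡ; inverseʳ)
open import Data.Vec using (lookup; _[_]≔_)
open import Data.Vec.Properties
  using (≡-dec; lookup∘tabulate; lookup-zipWith; lookup∘update; lookup∘update′; lookup-replicate)
open import Data.Vec.Relation.Binary.Pointwise.Extensional using (ext; extensional⇒inductive)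
open import Data.Vec.Relation.Binary.Pointwise.Inductive using (Pointwise-≡⇒≡)
open import Data.List using (List; []; _∷_; map; deduplicate)
open import Data.List.Membership.Propositional using (_∈_; _∉_)
open import Data.List.Membership.Propositional.Properties
  using (∈-map⁺; ∈-deduplicate⁺; ∈-deduplicate⁻)
open import Data.List.Relation.Unary.Any using (here; there)
import Data.List.Relation.Unary.All as All
open import Data.List.Relation.Unary.AllPairs using (AllPairs; _∷_)
open import Data.List.Relation.Unary.Linked as Linked using (Linked)
open import Data.List.Relation.Unary.Linked.Properties using (AllPairs⇒Linked; Linked⇒AllPairs)
open import Data.List.Relation.Unary.Unique.Propositional using (Unique)
open import Data.List.Relation.Unary.Unique.DecPropositional.Properties using (deduplicate-!)
open import Data.List.Relation.Binary.Permutation.Propositional using (↭-sym; ↭⇒↭ₛ)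
open import Data.List.Relation.Binary.Permutation.Propositional.Properties using (∈-resp-↭)
import Data.List.Relation.Binary.Permutation.Setoid.Properties as Permutationₛ
import Data.List.Sort as Sort
open import Data.Product using (Σ; ∃; _×_; _,_; proj₁; proj₂; map₁)
open import Data.Sum using (_⊎_; inj₁; inj₂; [_,_])
open import Data.Empty using (⊥)
open import Function using (_∘_; id)
open import Function.Bundles using (_⇔_; mk⇔; Equivalence)
open import Function.Construct.Composition using (_⇔-∘_)
open import Function.Construct.Symmetry using (⇔-sym)
open import Level using (0ℓ)
open import Relation.Nullary using (¬_; yes; no; contradiction)
open import Relation.Nullary.Decidable using (¬¬-excluded-middle)
open import Relation.Nullary.Negation using (¬¬-map)
open import Relation.Binary
  using (Rel; IsTotalOrder; TotalOrder; DecidableEquality; tri<; tri≈; tri>)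
open import Relation.Binary.PropositionalEquality
  using (_≡_; _≢_; refl; sym; trans; cong; cong₂; subst; setoid; module ≡-Reasoning)
open Equivalence using (to; from)
open ≡-Reasoning

lookup-≗⇒≡ : ∀ {d} {x y : Pt d} → (∀ i → lookup x i ≡ lookup y i) → x ≡ y
lookup-≗⇒≡ = Pointwise-≡⇒≡ ∘ extensional⇒inductive ∘ ext

lookup-⊕ : ∀ {d} (x y : Pt d) i → lookup (x ⊕ y) i ≡ lookup x i + lookup y i
lookup-⊕ x y i = lookup-zipWith _+_ i x y

lookup-𝐞-≡ : ∀ {d} (k : Fin d) → lookup (𝐞 k) k ≡ 1
lookup-𝐞-≡ k = lookup∘update k 𝟎 1

lookup-𝐞-≢ : ∀ {d} {i k : Fin d} → i ≢ k → lookup (𝐞 k) i ≡ 0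
lookup-𝐞-≢ {i = i} i≢k = trans (lookup∘update′ i≢k 𝟎 1) (lookup-replicate i 0)

𝐞⊕-decrement : ∀ {d} (x : Pt d) k → 1 ≤ lookup x k → 𝐞 k ⊕ (x [ k ]≔ (lookup x k ∸ 1)) ≡ x
𝐞⊕-decrement x k 1≤xₖ = lookup-≗⇒≡ λ i → trans (lookup-⊕ (𝐞 k) _ i) (coordinate i)
  where
  coordinate : ∀ i → lookup (𝐞 k) i + lookup (x [ k ]≔ (lookup x k ∸ 1)) i ≡ lookup x i
  coordinate i with i ≟ k
  ... | yes refl = trans (cong₂ _+_ (lookup-𝐞-≡ i) (lookup∘update i x _)) (m+[n∸m]≡n 1≤xₖ)
  ... | no i≢k = cong₂ _+_ (lookup-𝐞-≢ i≢k) (lookup∘update′ i≢k x _)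

lookup-act : ∀ {d} (π : Permutation′ d) x i → lookup (act π x) i ≡ lookup x (π ⟨$⟩ˡ i)
lookup-act π x = lookup∘tabulate _

act-flip-act : ∀ {d} (π : Permutation′ d) x → act (flip π) (act π x) ≡ x
act-flip-act π x = lookup-≗⇒≡ λ i → begin
  lookup (act (flip π) (act π x)) i  ≡⟨ lookup-act (flip π) (act π x) i ⟩
  lookup (act π x) (π ⟨$⟩ʳ i)        ≡⟨ lookup-act π x (π ⟨$⟩ʳ i) ⟩
  lookup x (π ⟨$⟩ˡ (π ⟨$⟩ʳ i))       ≡⟨ cong (lookup x) (inverseˡ π) ⟩
  lookup x i                         ∎

act-act-flip : ∀ {d} (π : Permutation′ d) x → act π (act (flip π) x) ≡ x
act-act-flip π x = lookup-≗⇒≡ λ i → begin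
  lookup (act π (act (flip π) x)) i  ≡⟨ lookup-act π (act (flip π) x) i ⟩
  lookup (act (flip π) x) (π ⟨$⟩ˡ i) ≡⟨ lookup-act (flip π) x (π ⟨$⟩ˡ i) ⟩
  lookup x (π ⟨$⟩ʳ (π ⟨$⟩ˡ i))       ≡⟨ cong (lookup x) (inverseʳ π) ⟩
  lookup x i                         ∎

act-flip-∘ₚ : ∀ {d} (π ρ : Permutation′ d) x → act (flip (π ∘ₚ ρ)) x ≡ act (flip π) (act (flip ρ) x)
act-flip-∘ₚ π ρ x = lookup-≗⇒≡ λ i → begin
  lookup (act (flip (π ∘ₚ ρ)) x) i          ≡⟨ lookup-act (flip (π ∘ₚ ρ)) x i ⟩
  lookup x (ρ ⟨$⟩ʳ (π ⟨$⟩ʳ i))              ≡⟨ lookup-act (flip ρ) x (π ⟨$⟩ʳ i) ⟨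
  lookup (act (flip ρ) x) (π ⟨$⟩ʳ i)        ≡⟨ lookup-act (flip π) (act (flip ρ) x) i ⟨
  lookup (act (flip π) (act (flip ρ) x)) i  ∎

act-𝐞 : ∀ {d} (π : Permutation′ d) k → act π (𝐞 k) ≡ 𝐞 (π ⟨$⟩ʳ k)
act-𝐞 π k = lookup-≗⇒≡ λ i → trans (lookup-act π (𝐞 k) i) (coordinate i)
  where
  coordinate : ∀ i → lookup (𝐞 k) (π ⟨$⟩ˡ i) ≡ lookup (𝐞 (π ⟨$⟩ʳ k)) i
  coordinate i with i ≟ π ⟨$⟩ʳ k
  ... | yes refl = trans (cong (lookup (𝐞 k)) (inverseˡ π))
                         (trans (lookup-𝐞-≡ k) (sym (lookup-𝐞-≡ (π ⟨$⟩ʳ k))))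
  ... | no i≢πk = trans (lookup-𝐞-≢ (λ πi≡k → i≢πk (trans (sym (inverseʳ π)) (cong (π ⟨$⟩ʳ_) πi≡k))))
                        (sym (lookup-𝐞-≢ i≢πk))

actSet⇔ : ∀ {d} (π : Permutation′ d) (P : PSet d) y → actSet π P y ⇔ P (act (flip π) y)
actSet⇔ π P y = mk⇔
  (λ { (x , Px , refl) → subst P (sym (act-flip-act π x)) Px })
  (λ P[π⁻¹y] → act (flip π) y , P[π⁻¹y] , act-act-flip π y)

transpose-swaps : ∀ {n} {i j : Fin n} → i ≢ j → PC.transpose j i i ≡ j
transpose-swaps {i = i} {j} i≢j with i ≟ j
... | yes i≡j = contradiction i≡j i≢j
... | no _ with i ≟ i
...   | yes _ = refl
...   | no i≢i = contradiction refl i≢i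

∘transpose-≗ : ∀ {n a} {A : Set a} (f : Fin n → A) {i j} → f i ≡ f j → ∀ k → f (PC.transpose i j k) ≡ f k
∘transpose-≗ f {i} {j} fi≡fj k with k ≟ i
... | yes refl = sym fi≡fj
... | no _ with k ≟ j
...   | yes refl = fi≡fj
...   | no _ = refl

act-transpose-𝐞 : ∀ {d} {i j : Fin d} → i ≢ j → act (flip (transpose i j)) (𝐞 i) ≡ 𝐞 j
act-transpose-𝐞 {i = i} {j} i≢j = trans (act-𝐞 (flip (transpose i j)) i) (cong 𝐞 (transpose-swaps i≢j))

act-transpose-id : ∀ {d} (x : Pt d) {i j} → lookup x i ≡ lookup x j → act (flip (transpose i j)) x ≡ x
act-transpose-id x xᵢ≡xⱼ = lookup-≗⇒≡ λ k →
  trans (lookup-act (flip (transpose _ _)) x k) (∘transpose-≗ (lookup x) xᵢ≡xⱼ k)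

FiniteGaps : ∀ {d} → PSet d → Set
FiniteGaps {d} P = Σ (List (Pt d)) λ L → ∀ x → ¬ P x → x ∈ L

FiniteGaps-resp-⇔ : ∀ {d} {P Q : PSet d} → (∀ x → P x ⇔ Q x) → FiniteGaps P → FiniteGaps Q
FiniteGaps-resp-⇔ P⇔Q (L , gaps∈L) = L , λ x ¬Qx → gaps∈L x (¬Qx ∘ to (P⇔Q x))

FiniteGaps-∘act : ∀ {d} (π : Permutation′ d) {P : PSet d} → FiniteGaps P → FiniteGaps (P ∘ act (flip π))
FiniteGaps-∘act π (L , gaps∈L) = map (act π) L , λ y ¬P[π⁻¹y] →
  subst (_∈ map (act π) L) (act-act-flip π y) (∈-map⁺ (act π) (gaps∈L _ ¬P[π⁻¹y]))

¬¬-filter : ∀ {a p} {A : Set a} (P : A → Set p) xs → ¬ ¬ (∃ λ ys → ∀ x → x ∈ ys ⇔ (x ∈ xs × P x))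
¬¬-filter P [] k = k ([] , λ x → mk⇔ (λ ()) λ { (() , _) })
¬¬-filter P (y ∷ xs) k = ¬¬-filter P xs λ (ys , ys⇔) → ¬¬-excluded-middle λ where
    (yes Py) → k (y ∷ ys , λ x → mk⇔ (keep ys⇔ Py) (keep⁻¹ ys⇔))
    (no ¬Py) → k (ys , λ x → mk⇔ (map₁ there ∘ to (ys⇔ x)) (drop⁻¹ ys⇔ ¬Py))
  where
  keep : ∀ {ys x} → (∀ x → x ∈ ys ⇔ (x ∈ xs × P x)) → P y → x ∈ y ∷ ys → x ∈ y ∷ xs × P x
  keep ys⇔ Py (here refl) = here refl , Py
  keep ys⇔ Py (there x∈ys) = map₁ there (to (ys⇔ _) x∈ys)
  keep⁻¹ : ∀ {ys x} → (∀ x → x ∈ ys ⇔ (x ∈ xs × P x)) → x ∈ y ∷ xs × P x → x ∈ y ∷ ys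
  keep⁻¹ ys⇔ (here refl , _) = here refl
  keep⁻¹ ys⇔ (there x∈xs , Px) = there (from (ys⇔ _) (x∈xs , Px))
  drop⁻¹ : ∀ {ys x} → (∀ x → x ∈ ys ⇔ (x ∈ xs × P x)) → ¬ P y → x ∈ y ∷ xs × P x → x ∈ ys
  drop⁻¹ ys⇔ ¬Py (here refl , Py) = contradiction Py ¬Py
  drop⁻¹ ys⇔ ¬Py (there x∈xs , Px) = from (ys⇔ _) (x∈xs , Px)

module RelaxedMonomialOrder {d : ℕ} {_⪯_ : Rel (Pt d) 0ℓ} (rmo : IsRelaxedMonomialOrder _⪯_) where
  open IsRelaxedMonomialOrder rmo
  open IsTotalOrder isTotalOrder using (total; reflexive)

  _≟ₚ_ : DecidableEquality (Pt d)
  _≟ₚ_ = ≡-dec _≟ℕ_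

  totalOrder : TotalOrder 0ℓ 0ℓ 0ℓ
  totalOrder = record { isTotalOrder = isTotalOrder }

  open import Relation.Binary.Properties.TotalOrder totalOrder
    using (decTotalOrder; <-trans; <-irrefl; <⇒≱)

  _≺_ : Rel (Pt d) 0ℓ
  _≺_ = Strict _⪯_

  open Sort (decTotalOrder _≟ₚ_) using (sort; sort-↭; sort-↗)

  ⪯-⊕ : ∀ v u → v ⪯ (v ⊕ u)
  ⪯-⊕ v u with total v (v ⊕ u)
  ... | inj₁ v⪯v⊕u = v⪯v⊕u
  ... | inj₂ v⊕u⪯v with (v ⊕ u) ≟ₚ v
  ...   | yes v⊕u≡v = reflexive (sym v⊕u≡v)
  ...   | no v⊕u≢v = contradiction refl (proj₂ (compat (v ⊕ u) v u (v⊕u⪯v , v⊕u≢v)))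

  𝐞-⪯ : ∀ x k → 1 ≤ lookup x k → 𝐞 k ⪯ x
  𝐞-⪯ x k 1≤xₖ = subst (𝐞 k ⪯_) (𝐞⊕-decrement x k 1≤xₖ) (⪯-⊕ (𝐞 k) _)

  ≺𝐞⇒lookup≡0 : ∀ {x k} → x ≺ 𝐞 k → lookup x k ≡ 0
  ≺𝐞⇒lookup≡0 {x} {k} x≺𝐞k with lookup x k in xₖ≡
  ... | zero = refl
  ... | suc _ = contradiction (𝐞-⪯ x k (subst (1 ≤_) (sym xₖ≡) (s≤s z≤n))) (<⇒≱ x≺𝐞k)

  strictSort : ∀ xs → ∃ λ ys → Linked _≺_ ys × (∀ x → x ∈ ys ⇔ x ∈ xs)
  strictSort xs = sort xs′ , Linked.zipWith id (sort-↗ xs′ , AllPairs⇒Linked unique) , ∈⇔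
    where
    xs′ = deduplicate _≟ₚ_ xs
    unique : Unique (sort xs′)
    unique = Permutationₛ.Unique-resp-↭ (setoid (Pt d)) (↭⇒↭ₛ (↭-sym (sort-↭ xs′))) (deduplicate-! _≟ₚ_ xs)
    ∈⇔ : ∀ x → x ∈ sort xs′ ⇔ x ∈ xs
    ∈⇔ x = mk⇔ (∈-deduplicate⁻ _≟ₚ_ xs ∘ ∈-resp-↭ (sort-↭ xs′))
               (∈-resp-↭ (↭-sym (sort-↭ xs′)) ∘ ∈-deduplicate⁺ _≟ₚ_)

  -- Membership in S is not decidable, so its sorted gap list exists only under double
  -- negation; this suffices since the gap lists are only used to reach a contradiction.
  ¬¬-sortedGaps : ∀ {S} → FiniteGaps S → ¬ ¬ ∃ (SortedGaps _⪯_ S)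
  ¬¬-sortedGaps {S} (L , gaps∈L) = ¬¬-map sortGaps (¬¬-filter (¬_ ∘ S) L)
    where
    sortGaps : (∃ λ ys → ∀ x → x ∈ ys ⇔ (x ∈ L × ¬ S x)) → ∃ (SortedGaps _⪯_ S)
    sortGaps (ys , ys⇔) with strictSort ys
    ... | hs , hs↗ , hs⇔ys = hs , hs↗ , λ x → mk⇔
      (proj₂ ∘ to (ys⇔ x) ∘ to (hs⇔ys x))
      (λ ¬Sx → from (hs⇔ys x) (from (ys⇔ x) (gaps∈L x ¬Sx , ¬Sx)))

  record FirstDifference (hs hs' : List (Pt d)) : Set where
    field
      point : Pt d
      ∈ˡ    : point ∈ hs
      ∉ʳ    : point ∉ hs'
      below : ∀ {z} → z ∈ hs' → z ≺ point → z ∈ hs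

  firstDifference : ∀ {hs hs'} → AllPairs _≺_ hs → AllPairs _≺_ hs' →
                    FirstDiffLess _⪯_ hs hs' → FirstDifference hs hs'
  firstDifference {x ∷ _} {y ∷ ys} _ (y≺ys ∷ _) (here x≺y) = record
    { point = x
    ; ∈ˡ    = here refl
    ; ∉ʳ    = λ x∈y∷ys → <⇒≱ x≺y (least x∈y∷ys)
    ; below = λ z∈y∷ys z≺x → contradiction (least z∈y∷ys) (<⇒≱ (<-trans z≺x x≺y))
    }
    where
    least : ∀ {z} → z ∈ y ∷ ys → y ⪯ z
    least (here refl)  = reflexive refl
    least (there z∈ys) = proj₁ (All.lookup y≺ys z∈ys)
  firstDifference {x ∷ _} {x ∷ _} (x≺xs ∷ xs↗) (_ ∷ ys↗) (there diff) = record
    { point = point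
    ; ∈ˡ    = there ∈ˡ
    ; ∉ʳ    = λ { (here refl) → <-irrefl refl (All.lookup x≺xs ∈ˡ) ; (there p∈ys) → ∉ʳ p∈ys }
    ; below = λ { (here refl) _ → here refl ; (there z∈ys) z≺p → there (below z∈ys z≺p) }
    }
    where open FirstDifference (firstDifference xs↗ ys↗ diff)

  earlierGap⇒¬≤R : ∀ {S S' : PSet d} {p} → FiniteGaps S → FiniteGaps S' → S p → ¬ S' p →
                   (∀ x → x ⪯ p → ¬ S x → ¬ S' x) → ¬ (S ≤R[ _⪯_ ] S')
  earlierGap⇒¬≤R _ _ Sp ¬S'p _ (inj₁ S⇔S') = ¬S'p (to (S⇔S' _) Sp)
  earlierGap⇒¬≤R {S} {S'} {p} finS finS' Sp ¬S'p gapsKept (inj₂ ≤R) =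
    ¬¬-sortedGaps finS λ (hs , hs-gaps) → ¬¬-sortedGaps finS' λ (hs' , hs'-gaps) →
    absurd hs-gaps hs'-gaps (firstDifference (↗⇒AllPairs hs-gaps) (↗⇒AllPairs hs'-gaps)
                                             (≤R hs hs' hs-gaps hs'-gaps))
    where
    ↗⇒AllPairs : ∀ {P hs} → SortedGaps _⪯_ P hs → AllPairs _≺_ hs
    ↗⇒AllPairs = Linked⇒AllPairs <-trans ∘ proj₁
    absurd : ∀ {hs hs'} → SortedGaps _⪯_ S hs → SortedGaps _⪯_ S' hs' → ¬ FirstDifference hs hs'
    absurd (_ , hs⇔) (_ , hs'⇔) diff = [ point-kept , p-earlier ] (total point p)
      where
      open FirstDifference diff
      ¬S-point : ¬ S point
      ¬S-point = to (hs⇔ point) ∈ˡ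
      point-kept : point ⪯ p → ⊥
      point-kept point⪯p = ∉ʳ (from (hs'⇔ point) (gapsKept point point⪯p ¬S-point))
      p-earlier : p ⪯ point → ⊥
      p-earlier p⪯point = to (hs⇔ p) (below (from (hs'⇔ p) ¬S'p) p≺point) Sp
        where
        p≺point : p ≺ point
        p≺point = p⪯point , λ p≡point → ¬S-point (subst S p≡point Sp)

  module _ (𝐞-≺ : ∀ (i j : Fin d) → i <ᶠ j → 𝐞 i ≺ 𝐞 j) where

    𝐞≺𝐞⇒< : ∀ {i j} → 𝐞 i ≺ 𝐞 j → i <ᶠ j
    𝐞≺𝐞⇒< {i} {j} 𝐞i≺𝐞j with <-cmp i j
    ... | tri< i<j _ _   = i<j
    ... | tri≈ _ refl _ = contradiction refl (proj₂ 𝐞i≺𝐞j)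
    ... | tri> _ _ j<i   = contradiction (proj₁ 𝐞i≺𝐞j) (<⇒≱ (𝐞-≺ j i j<i))

    basisGap-downward : ∀ {S} → InR _⪯_ S → ∀ {t j} → t <ᶠ j → ¬ S (𝐞 j) → ¬ S (𝐞 t)
    basisGap-downward {S} (S₀ , S₀-gns , (σ₀ , S⇔σ₀S₀) , minimal) {t} {j} t<j ¬S𝐞j S𝐞t =
      earlierGap⇒¬≤R finS finS' S𝐞t ¬S'𝐞t gapsKept (minimal (σ₀ ∘ₚ τ))
      where
      τ = transpose t j
      S' = actSet (σ₀ ∘ₚ τ) S₀
      S⇔S₀ : ∀ x → S x ⇔ S₀ (act (flip σ₀) x)
      S⇔S₀ x = actSet⇔ σ₀ S₀ x ⇔-∘ S⇔σ₀S₀ x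
      S'⇔S : ∀ y → S' y ⇔ S (act (flip τ) y)
      S'⇔S y = ⇔-sym (S⇔S₀ _) ⇔-∘ subst (λ z → S' y ⇔ S₀ z) (act-flip-∘ₚ σ₀ τ y) (actSet⇔ (σ₀ ∘ₚ τ) S₀ y)
      finS : FiniteGaps S
      finS = FiniteGaps-resp-⇔ (⇔-sym ∘ S⇔S₀) (FiniteGaps-∘act σ₀ (IsGNS.finiteGaps S₀-gns))
      finS' : FiniteGaps S'
      finS' = FiniteGaps-resp-⇔ (⇔-sym ∘ S'⇔S) (FiniteGaps-∘act τ finS)
      ¬S'𝐞t : ¬ S' (𝐞 t)
      ¬S'𝐞t = ¬S𝐞j ∘ subst S (act-transpose-𝐞 (<⇒≢ t<j)) ∘ to (S'⇔S (𝐞 t))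
      gapsKept : ∀ x → x ⪯ 𝐞 t → ¬ S x → ¬ S' x
      gapsKept x x⪯𝐞t ¬Sx = ¬Sx ∘ subst S (act-transpose-id x (trans xₜ≡0 (sym xⱼ≡0))) ∘ to (S'⇔S x)
        where
        x≺𝐞t : x ≺ 𝐞 t
        x≺𝐞t = x⪯𝐞t , λ x≡𝐞t → ¬Sx (subst S (sym x≡𝐞t) S𝐞t)
        xₜ≡0 : lookup x t ≡ 0
        xₜ≡0 = ≺𝐞⇒lookup≡0 x≺𝐞t
        xⱼ≡0 : lookup x j ≡ 0
        xⱼ≡0 = ≺𝐞⇒lookup≡0 (<-trans x≺𝐞t (𝐞-≺ t j t<j))

downClosed-pair≡0,1 : ∀ {n} (G : Fin n → Set) → (∀ {t j} → t <ᶠ j → G j → G t) →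
                      ∀ {j₁ j₂} → j₁ <ᶠ j₂ → (∀ i → G i ⇔ (i ≡ j₁ ⊎ i ≡ j₂)) →
                      toℕ j₁ ≡ 0 × toℕ j₂ ≡ 1
downClosed-pair≡0,1 G down {0F} {0F} () _
downClosed-pair≡0,1 G down {0F} {sucF 0F} _ _ = refl , refl
downClosed-pair≡0,1 G down {0F} {sucF (sucF k)} _ G⇔
  with to (G⇔ (sucF 0F)) (down (s≤s (s≤s z≤n)) (from (G⇔ _) (inj₂ refl)))
... | inj₁ ()
... | inj₂ ()
downClosed-pair≡0,1 G down {sucF k} {j₂} j₁<j₂ G⇔
  with to (G⇔ 0F) (down (s≤s z≤n) (from (G⇔ _) (inj₁ refl)))
... | inj₁ ()
downClosed-pair≡0,1 G down {sucF k} {.0F} () G⇔ | inj₂ refl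

mainTheorem11 : (d : ℕ) → 1 ≤ d → (_⪯_ : Rel (Pt d) 0ℓ) → IsRelaxedMonomialOrder _⪯_ →
    (∀ (i j : Fin d) → i <ᶠ j → Strict _⪯_ (𝐞 i) (𝐞 j)) →
    (S : PSet d) → InR _⪯_ S →
    (j₁ j₂ : Fin d) → Strict _⪯_ (𝐞 j₁) (𝐞 j₂) →
    (∀ (i : Fin d) → (¬ S (𝐞 i)) ⇔ (i ≡ j₁ ⊎ i ≡ j₂)) →
    (toℕ j₁ ≡ 0 × toℕ j₂ ≡ 1) ⊎ (toℕ j₁ ≡ 1 × toℕ j₂ ≡ 0)
mainTheorem11 d _ _⪯_ rmo 𝐞-≺ S S∈R j₁ j₂ 𝐞j₁≺𝐞j₂ basisGaps =
  inj₁ (downClosed-pair≡0,1 (λ i → ¬ S (𝐞 i)) (basisGap-downward 𝐞-≺ S∈R) (𝐞≺𝐞⇒< 𝐞-≺ 𝐞j₁≺𝐞j₂) basisGaps)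
  where open RelaxedMonomialOrder rmo
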